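{- Let $\mathcal{B}$ be the set of blocking games. If $G\in\mathcal{P}_{\mathcal{B}}(\mathcal{B})$ and $o(G)\neq\mathscr{R}$, then $G$ is Left $\mathcal{B}$-strong.
   Context: Games are short misère-play game forms; outcomes $o(G)\in\{\mathscr{L},\mathscr{N},\mathscr{P},\mathscr{R}\}$ (ordered $\mathscr{L}>\mathscr{N}>\mathscr{R}$, $\mathscr{L}>\mathscr{P}>\mathscr{R}$); $o_L(G)$ is the outcome when Left moves first. $+$ is disjunctive sum. A subposition is any game reachable by a possibly empty, not necessarily alternating, sequence of moves; strictly $\mathscr{P}$-free: no subposition has outcome $\mathscr{P}$. $G\geq_{\mathcal{B}}H$ iff $o(G+X)\geq o(H+X)$ for all $X\in\mathcal{B}$; $\equiv_{\mathcal{B}}$ is the associated equivalence; $\mathcal{P}_{\mathcal{B}}(\mathcal{B})$ is the set of $G\in\mathcal{B}$ with $G\equiv_{\mathcal{B}}H$ for some strictly $\mathscr{P}$-free $H\in\mathcal{B}$. A Left end is a game with no Left options. A Left end $X$ is blocked if for every Right option $X^R$, either $X^R$ is a blocked Left end or some Left option $X^{RL}$ of $X^R$ is a blocked Left end; blocked Right ends symmetrically. A game is blocking if every subposition that is a Left (resp. Right) end is a blocked Left (resp. Right) end; $\mathcal{B}$ is the set of blocking games. $G$ is Left $\mathcal{B}$-strong if $o_L(G+X)=\mathscr{L}$ for every Left end $X\in\mathcal{B}$. -}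

module Defs where

open import Data.Bool using (Bool; true; false; _∧_; _∨_)
open import Data.List using (List; []; _∷_; _++_)
open import Data.List.Membership.Propositional using (_∈_)
open import Data.Product using (Σ; _×_; _,_)
open import Data.Sum using (_⊎_)
open import Relation.Binary.PropositionalEquality using (_≡_)
open import Relation.Nullary using (¬_)

data Game : Set where
  mk : List Game → List Game → Game

leftOpts : Game → List Game
leftOpts (mk l _) = l

rightOpts : Game → List Game
rightOpts (mk _ r) = r

-- Misère outcomes.
-- winsLL G : Left wins G when Left moves first.
-- winsLR G : Left wins G when Right moves first.
-- Misère convention: a player with no move on their turn wins.
mutual
  winsLL : Game → Bool
  winsLL (mk [] _) = true
  winsLL (mk (g ∷ gs) _) = anyR (g ∷ gs)

  winsLR : Game → Bool
  winsLR (mk _ []) = false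
  winsLR (mk _ (g ∷ gs)) = allL (g ∷ gs)

  anyR : List Game → Bool
  anyR [] = false
  anyR (g ∷ gs) = winsLR g ∨ anyR gs

  allL : List Game → Bool
  allL [] = true
  allL (g ∷ gs) = winsLL g ∧ allL gs

data Outcome : Set where
  𝓛 𝓝 𝓟 𝓡 : Outcome

outcomeOf : Bool → Bool → Outcome
outcomeOf true  true  = 𝓛
outcomeOf true  false = 𝓝
outcomeOf false true  = 𝓟
outcomeOf false false = 𝓡

o : Game → Outcome
o G = outcomeOf (winsLL G) (winsLR G)

oL : Game → Outcome
oL G with winsLL G
... | true  = 𝓛
... | false = 𝓡

data _≤o_ : Outcome → Outcome → Set where
  refl≤ : ∀ {a} → a ≤o a
  𝓡≤ : ∀ {a} → 𝓡 ≤o a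
  ≤𝓛 : ∀ {a} → a ≤o 𝓛

mutual
  _+_ : Game → Game → Game
  G@(mk gl gr) + H@(mk hl hr) = mk (addˡ gl H ++ addʳ G hl) (addˡ gr H ++ addʳ G hr)

  addˡ : List Game → Game → List Game
  addˡ [] H = []
  addˡ (g ∷ gs) H = (g + H) ∷ addˡ gs H

  addʳ : Game → List Game → List Game
  addʳ G [] = []
  addʳ G (h ∷ hs) = (G + h) ∷ addʳ G hs

infixl 6 _+_

data Subposition : Game → Game → Set where
  here : ∀ {G} → Subposition G G
  viaL : ∀ {K G G'} → G' ∈ leftOpts G → Subposition K G' → Subposition K G
  viaR : ∀ {K G G'} → G' ∈ rightOpts G → Subposition K G' → Subposition K G

StrictlyPFree : Game → Set
StrictlyPFree H = ∀ K → Subposition K H → ¬ (o K ≡ 𝓟)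

LeftEnd : Game → Set
LeftEnd X = leftOpts X ≡ []

RightEnd : Game → Set
RightEnd X = rightOpts X ≡ []

data BlockedLeftEnd : Game → Set where
  blockedL : ∀ {rs} →
    (∀ {XR} → XR ∈ rs →
       BlockedLeftEnd XR ⊎ Σ Game (λ XRL → XRL ∈ leftOpts XR × BlockedLeftEnd XRL)) →
    BlockedLeftEnd (mk [] rs)

data BlockedRightEnd : Game → Set where
  blockedR : ∀ {ls} →
    (∀ {XL} → XL ∈ ls →
       BlockedRightEnd XL ⊎ Σ Game (λ XLR → XLR ∈ rightOpts XL × BlockedRightEnd XLR)) →
    BlockedRightEnd (mk ls [])

Blocking : Game → Set
Blocking G = ∀ K → Subposition K G →
  (LeftEnd K → BlockedLeftEnd K) × (RightEnd K → BlockedRightEnd K)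

_≥𝓑_ : Game → Game → Set
G ≥𝓑 H = ∀ X → Blocking X → o (H + X) ≤o o (G + X)

_≡𝓑_ : Game → Game → Set
G ≡𝓑 H = (G ≥𝓑 H) × (H ≥𝓑 G)

InP𝓑 : Game → Set
InP𝓑 G = Blocking G × Σ Game (λ H → Blocking H × StrictlyPFree H × (G ≡𝓑 H))

LeftStrong𝓑 : Game → Set
LeftStrong𝓑 G = ∀ X → Blocking X → LeftEnd X → oL (G + X) ≡ 𝓛

{-# OPTIONS --safe #-}
module Submission where

-- Since 0 is blocking, o(H) = o(G) ≠ 𝓡 for the strictly 𝓟-free H ≡𝓑 G, and o(H) ≠ 𝓟, so
-- Left wins H moving first. For strictly 𝓟-free K and a blocked Left end X, Left's wins
-- in K (moving first or second) survive in K + X, by induction on K and on X: Left keeps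
-- answering in K; when Right moves X to X^R, either X^R is again a blocked Left end and
-- Left, winning K second with K not 𝓟, also wins K moving first, or Left moves X^R to the
-- blocked Left end X^RL and is back in K + X^RL with Right to move. Finally
-- o(G + X) = o(H + X) transfers the win from H + X to G + X.

open import Defs
open import Relation.Binary.PropositionalEquality using (_≡_)
open import Relation.Nullary using (¬_)

open import Data.Bool using (Bool; true; false; T; _∨_; _∧_)
open import Data.Bool.ListAction using (any; all)
open import Data.Empty using (⊥-elim)
open import Data.List using ([]; _∷_; _++_; map)
open import Data.List.Membership.Propositional using (_∈_; find; lose)
open import Data.List.Membership.Propositional.Properties
  using (∈-++⁺ˡ; ∈-++⁺ʳ; ∈-++⁻; ∈-map⁺; ∈-map⁻)
open import Data.List.Relation.Unary.All as All using ()
open import Data.List.Relation.Unary.All.Properties using (all⁺; all⁻)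
open import Data.List.Relation.Unary.Any using (here; there)
open import Data.List.Relation.Unary.Any.Properties using (any⁺; any⁻)
open import Data.Product using (_×_; _,_; proj₁; proj₂; ∃-syntax)
open import Data.Sum using (_⊎_; inj₁; inj₂)
open import Data.Unit using (tt)
open import Function using (_∘_)
open import Induction.WellFounded using (Acc; acc; WellFounded)
open import Relation.Binary.PropositionalEquality
  using (refl; sym; trans; cong; cong₂; subst; module ≡-Reasoning)

private
  variable
    G H K X g h : Game

anyR≡any : ∀ gs → anyR gs ≡ any winsLR gs
anyR≡any []       = refl
anyR≡any (g ∷ gs) = cong (winsLR g ∨_) (anyR≡any gs)

allL≡all : ∀ gs → allL gs ≡ all winsLL gs
allL≡all []       = refl
allL≡all (g ∷ gs) = cong (winsLL g ∧_) (allL≡all gs)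

winsLL-leftEnd : ∀ G → LeftEnd G → T (winsLL G)
winsLL-leftEnd (mk [] _) refl = tt

winsLL-intro : ∀ G → g ∈ leftOpts G → T (winsLR g) → T (winsLL G)
winsLL-intro (mk (l ∷ ls) _) g∈ wins rewrite anyR≡any (l ∷ ls) =
  any⁺ winsLR (lose g∈ wins)

winsLL-elim : ∀ G → T (winsLL G) → LeftEnd G ⊎ ∃[ g ] g ∈ leftOpts G × T (winsLR g)
winsLL-elim (mk []       _) _    = inj₁ refl
winsLL-elim (mk (l ∷ ls) _) wins rewrite anyR≡any (l ∷ ls) =
  inj₂ (find (any⁻ winsLR (l ∷ ls) wins))

winsLR-intro : ∀ G → g ∈ rightOpts G → (∀ {h} → h ∈ rightOpts G → T (winsLL h)) →
               T (winsLR G)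
winsLR-intro (mk _ (r ∷ rs)) _ wins rewrite allL≡all (r ∷ rs) =
  all⁻ winsLL (All.tabulate wins)

winsLR-elim : ∀ G → T (winsLR G) → h ∈ rightOpts G → T (winsLL h)
winsLR-elim (mk _ (r ∷ rs)) wins rewrite allL≡all (r ∷ rs) =
  All.lookup (all⁺ winsLL (r ∷ rs) wins)

winsLR-rightOpt : ∀ G → T (winsLR G) → ∃[ g ] g ∈ rightOpts G
winsLR-rightOpt (mk _ (r ∷ _)) _ = r , here refl

winsLL-if-¬𝓡-¬𝓟 : ∀ G → ¬ o G ≡ 𝓡 → ¬ o G ≡ 𝓟 → T (winsLL G)
winsLL-if-¬𝓡-¬𝓟 G ¬𝓡 ¬𝓟 with winsLL G | winsLR G
... | true  | _     = tt
... | false | true  = ⊥-elim (¬𝓟 refl)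
... | false | false = ⊥-elim (¬𝓡 refl)

winsLR⇒¬𝓡 : ∀ G → T (winsLR G) → ¬ o G ≡ 𝓡
winsLR⇒¬𝓡 G wins with winsLL G | winsLR G
... | true  | true  = λ ()
... | true  | false = λ ()
... | false | true  = λ ()
... | false | false = ⊥-elim wins

oL≡𝓛 : ∀ G → T (winsLL G) → oL G ≡ 𝓛
oL≡𝓛 G wins with winsLL G
... | true = refl

leftWinsFirst : Outcome → Bool
leftWinsFirst 𝓛 = true
leftWinsFirst 𝓝 = true
leftWinsFirst 𝓟 = false
leftWinsFirst 𝓡 = false

leftWinsFirst-outcomeOf : ∀ a b → leftWinsFirst (outcomeOf a b) ≡ a
leftWinsFirst-outcomeOf true  true  = refl
leftWinsFirst-outcomeOf true  false = refl
leftWinsFirst-outcomeOf false true  = refl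
leftWinsFirst-outcomeOf false false = refl

o≡⇒winsLL≡ : ∀ G H → o G ≡ o H → winsLL G ≡ winsLL H
o≡⇒winsLL≡ G H oG≡oH = begin
  winsLL G                ≡⟨ sym (leftWinsFirst-outcomeOf (winsLL G) (winsLR G)) ⟩
  leftWinsFirst (o G)     ≡⟨ cong leftWinsFirst oG≡oH ⟩
  leftWinsFirst (o H)     ≡⟨ leftWinsFirst-outcomeOf (winsLL H) (winsLR H) ⟩
  winsLL H                ∎
  where open ≡-Reasoning

addˡ≡map : ∀ gs H → addˡ gs H ≡ map (_+ H) gs
addˡ≡map []       H = refl
addˡ≡map (g ∷ gs) H = cong (g + H ∷_) (addˡ≡map gs H)

addʳ≡map : ∀ G hs → addʳ G hs ≡ map (G +_) hs
addʳ≡map G []       = refl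
addʳ≡map G (h ∷ hs) = cong (G + h ∷_) (addʳ≡map G hs)

leftOpts-+ : ∀ G H → leftOpts (G + H) ≡ map (_+ H) (leftOpts G) ++ map (G +_) (leftOpts H)
leftOpts-+ G@(mk gl _) H@(mk hl _) = cong₂ _++_ (addˡ≡map gl H) (addʳ≡map G hl)

rightOpts-+ : ∀ G H → rightOpts (G + H) ≡ map (_+ H) (rightOpts G) ++ map (G +_) (rightOpts H)
rightOpts-+ G@(mk _ gr) H@(mk _ hr) = cong₂ _++_ (addˡ≡map gr H) (addʳ≡map G hr)

+-leftOptˡ : ∀ G H → g ∈ leftOpts G → g + H ∈ leftOpts (G + H)
+-leftOptˡ G H g∈ rewrite leftOpts-+ G H = ∈-++⁺ˡ (∈-map⁺ (_+ H) g∈)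

+-leftOptʳ : ∀ G H → h ∈ leftOpts H → G + h ∈ leftOpts (G + H)
+-leftOptʳ G H h∈ rewrite leftOpts-+ G H = ∈-++⁺ʳ _ (∈-map⁺ (G +_) h∈)

+-rightOptˡ : ∀ G H → g ∈ rightOpts G → g + H ∈ rightOpts (G + H)
+-rightOptˡ G H g∈ rewrite rightOpts-+ G H = ∈-++⁺ˡ (∈-map⁺ (_+ H) g∈)

+-rightOpt⁻ : ∀ G H {k} → k ∈ rightOpts (G + H) →
              (∃[ g ] g ∈ rightOpts G × k ≡ g + H) ⊎ (∃[ h ] h ∈ rightOpts H × k ≡ G + h)
+-rightOpt⁻ G H k∈ rewrite rightOpts-+ G H with ∈-++⁻ (map (_+ H) (rightOpts G)) k∈
... | inj₁ k∈ˡ = inj₁ (∈-map⁻ (_+ H) k∈ˡ)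
... | inj₂ k∈ʳ = inj₂ (∈-map⁻ (G +_) k∈ʳ)

+-leftEnd : ∀ G H → LeftEnd G → LeftEnd H → LeftEnd (G + H)
+-leftEnd G H G-end H-end rewrite leftOpts-+ G H | G-end | H-end = refl

0ᴳ : Game
0ᴳ = mk [] []

mutual
  +-identityʳ : ∀ G → G + 0ᴳ ≡ G
  +-identityʳ (mk l r) = cong₂ mk (addˡ-identityʳ l) (addˡ-identityʳ r)

  addˡ-identityʳ : ∀ gs → addˡ gs 0ᴳ ++ [] ≡ gs
  addˡ-identityʳ []       = refl
  addˡ-identityʳ (g ∷ gs) = cong₂ _∷_ (+-identityʳ g) (addˡ-identityʳ gs)

_◃_ : Game → Game → Set
g ◃ G = g ∈ leftOpts G ⊎ g ∈ rightOpts G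

mutual
  ◃-wellFounded : WellFounded _◃_
  ◃-wellFounded (mk ls rs) = acc λ where
    (inj₁ g∈) → ∈-acc ls g∈
    (inj₂ g∈) → ∈-acc rs g∈

  ∈-acc : ∀ gs → g ∈ gs → Acc _◃_ g
  ∈-acc (g ∷ _)  (here refl) = ◃-wellFounded g
  ∈-acc (_ ∷ gs) (there g∈)  = ∈-acc gs g∈

blockedLeftEnd⇒leftEnd : BlockedLeftEnd X → LeftEnd X
blockedLeftEnd⇒leftEnd (blockedL _) = refl

strictlyPFree-leftOpt : StrictlyPFree K → g ∈ leftOpts K → StrictlyPFree g
strictlyPFree-leftOpt pFree g∈ J J≤g = pFree J (viaL g∈ J≤g)

strictlyPFree-rightOpt : StrictlyPFree K → g ∈ rightOpts K → StrictlyPFree g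
strictlyPFree-rightOpt pFree g∈ J J≤g = pFree J (viaR g∈ J≤g)

mutual
  winsLL-+-blockedLeftEnd : StrictlyPFree K → Acc _◃_ K → BlockedLeftEnd X →
                            T (winsLL K) → T (winsLL (K + X))
  winsLL-+-blockedLeftEnd {K} {X} pFree (acc rec) X-blocked wins with winsLL-elim K wins
  ... | inj₁ K-end =
    winsLL-leftEnd (K + X) (+-leftEnd K X K-end (blockedLeftEnd⇒leftEnd X-blocked))
  ... | inj₂ (g , g∈ , g-wins) =
    winsLL-intro (K + X) (+-leftOptˡ K X g∈)
      (winsLR-+-blockedLeftEnd (strictlyPFree-leftOpt pFree g∈) (rec (inj₁ g∈))
        X-blocked g-wins)

  winsLR-+-blockedLeftEnd : StrictlyPFree K → Acc _◃_ K → BlockedLeftEnd X →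
                            T (winsLR K) → T (winsLR (K + X))
  winsLR-+-blockedLeftEnd {K} {X} pFree K-acc X-blocked wins =
    winsLR-intro (K + X) (+-rightOptˡ K X (proj₂ (winsLR-rightOpt K wins)))
      (winsLL-rightOpts-+ pFree K-acc X-blocked wins)

  winsLL-rightOpts-+ : StrictlyPFree K → Acc _◃_ K → BlockedLeftEnd X → T (winsLR K) →
                      ∀ {k} → k ∈ rightOpts (K + X) → T (winsLL k)
  -- Each clause matches only the argument it recurses on, so the calls stay structural.
  winsLL-rightOpts-+ {K} {X} pFree K-acc X-blocked wins k∈ with +-rightOpt⁻ K X k∈
  winsLL-rightOpts-+ {K} {X} pFree (acc rec) X-blocked wins k∈ | inj₁ (g , g∈ , refl) =
    winsLL-+-blockedLeftEnd (strictlyPFree-rightOpt pFree g∈) (rec (inj₂ g∈)) X-blocked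
      (winsLR-elim K wins g∈)
  winsLL-rightOpts-+ {K} {X} pFree K-acc (blockedL blocked) wins k∈ | inj₂ (x , x∈ , refl) =
    winsLL-+-rightOptOfBlocked pFree K-acc (blocked x∈) wins

  winsLL-+-rightOptOfBlocked :
    StrictlyPFree K → Acc _◃_ K →
    BlockedLeftEnd X ⊎ ∃[ Y ] Y ∈ leftOpts X × BlockedLeftEnd Y →
    T (winsLR K) → T (winsLL (K + X))
  winsLL-+-rightOptOfBlocked {K} pFree K-acc (inj₁ X-blocked) wins =
    winsLL-+-blockedLeftEnd pFree K-acc X-blocked
      (winsLL-if-¬𝓡-¬𝓟 K (winsLR⇒¬𝓡 K wins) (pFree K here))
  winsLL-+-rightOptOfBlocked {K} {X} pFree K-acc (inj₂ (Y , Y∈ , Y-blocked)) wins =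
    winsLL-intro (K + X) (+-leftOptʳ K X Y∈)
      (winsLR-+-blockedLeftEnd pFree K-acc Y-blocked wins)

≤o-antisym : ∀ {a b} → a ≤o b → b ≤o a → a ≡ b
≤o-antisym refl≤ _     = refl
≤o-antisym 𝓡≤   refl≤ = refl
≤o-antisym 𝓡≤   𝓡≤   = refl
≤o-antisym ≤𝓛   refl≤ = refl
≤o-antisym ≤𝓛   ≤𝓛   = refl

≡𝓑⇒o-+-≡ : ∀ G H → G ≡𝓑 H → Blocking X → o (G + X) ≡ o (H + X)
≡𝓑⇒o-+-≡ {X} _ _ (G≥H , H≥G) X-blocking =
  ≤o-antisym (H≥G X X-blocking) (G≥H X X-blocking)

0ᴳ-blocking : Blocking 0ᴳ
0ᴳ-blocking _ here         = (λ _ → blockedL λ ()) , (λ _ → blockedR λ ())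
0ᴳ-blocking _ (viaL () _)
0ᴳ-blocking _ (viaR () _)

≡𝓑⇒o-≡ : ∀ G H → G ≡𝓑 H → o G ≡ o H
≡𝓑⇒o-≡ G H G≡H = begin
  o G         ≡⟨ cong o (sym (+-identityʳ G)) ⟩
  o (G + 0ᴳ)  ≡⟨ ≡𝓑⇒o-+-≡ G H G≡H 0ᴳ-blocking ⟩
  o (H + 0ᴳ)  ≡⟨ cong o (+-identityʳ H) ⟩
  o H         ∎
  where open ≡-Reasoning

lemma4p4 : (G : Game) → InP𝓑 G → ¬ (o G ≡ 𝓡) → LeftStrong𝓑 G
lemma4p4 G (_ , H , _ , H-pFree , G≡H) oG≢𝓡 X X-blocking X-end =
  oL≡𝓛 (G + X) (subst T (sym G+X≡H+X) H+X-wins)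
  where
  H-wins : T (winsLL H)
  H-wins = winsLL-if-¬𝓡-¬𝓟 H (oG≢𝓡 ∘ trans (≡𝓑⇒o-≡ G H G≡H)) (H-pFree H here)

  H+X-wins : T (winsLL (H + X))
  H+X-wins = winsLL-+-blockedLeftEnd H-pFree (◃-wellFounded H)
               (proj₁ (X-blocking X here) X-end) H-wins

  G+X≡H+X : winsLL (G + X) ≡ winsLL (H + X)
  G+X≡H+X = o≡⇒winsLL≡ (G + X) (H + X) (≡𝓑⇒o-+-≡ G H G≡H X-blocking)
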